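{- Let $a_0,a_1,a_2$ be nonzero integers such that $a_0\equiv 0\pmod 9$, $a_1\equiv 1\pmod 3$, and $a_2\equiv 2\pmod 3$. Then there exist integers $b_0,b_1,b_2$ such that $b_0^2+b_1^2+b_2^2=a_0^2+a_1^2+a_2^2$ and $a_0\notin\{b_0,b_1,b_2\}$ and $-a_0\notin\{b_0,b_1,b_2\}$. -}

module Defs where

open import Data.Integer using (ℤ; _-_)
open import Data.Integer.Divisibility using (_∣_)

_≡_[mod_] : ℤ → ℤ → ℤ → Set
a ≡ r [mod m ] = m ∣ (a - r)

{-# OPTIONS --safe #-}
-- Write a₀ = 9k.  Reflecting (a₀, a₁, a₂) in the planes orthogonal to (1, 1, 1) and (-1, 1, 1)
-- gives two integer triples u and v with the same sum of squares, since 3 divides ±a₀ + a₁ + a₂.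
-- Reflection shifts all coordinates by the same amount, so the coordinates of u are pairwise
-- incongruent mod 3 like a₀, a₁, a₂, and only one of them is divisible by 3; as v ≡ u (mod 3),
-- the other two differ from ±a₀ in both u and v.  In the remaining coordinate v and u differ by
-- 12k or -6k, which is neither 0 nor ±18k, so ±a₀ cannot occur there in both triples.
module Submission where

open import Defs
open import Data.Integer using (ℤ; _+_; _*_; -_; +_; _-_; 0ℤ; ≢-nonZero)
open import Data.Integer.Properties
  using (_≟_; +-identityʳ; +-inverseʳ; neg-distrib-+; neg-involutive; neg-distribʳ-*; *-zeroʳ;
         *-distribˡ-+; *-cancelˡ-≡)
open import Data.Integer.Divisibility.Signed
  using (_∣_; divides; _∣?_; ∣ᵤ⇒∣; ∣-refl; ∣m∣n⇒∣m+n; ∣m∣n⇒∣m-n; ∣m+n∣m⇒∣n; ∣m⇒∣-m; ∣n⇒∣m*n)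
open import Data.Integer.Tactic.RingSolver using (solve-∀)
open import Data.Product using (∃-syntax; _×_; _,_)
open import Data.Sum using (_⊎_; inj₁; inj₂; map; [_,_]′)
open import Relation.Binary.PropositionalEquality
  using (_≡_; _≢_; refl; sym; trans; cong; subst; module ≡-Reasoning)
open import Relation.Nullary using (¬_; yes; no)
open import Relation.Nullary.Decidable using (from-no)

infix 4 _≢±_

_≢±_ : ℤ → ℤ → Set
x ≢± a = x ≢ a × x ≢ - a

Avoiding : ℤ → ℤ → ℤ → ℤ → Set
Avoiding a x y z = x ≢± a × y ≢± a × z ≢± a

norm² : ℤ → ℤ → ℤ → ℤ
norm² x y z = x * x + y * y + z * z

AvoidingRepresentation : ℤ → ℤ → ℤ → Set
AvoidingRepresentation a₀ a₁ a₂ = ∃[ b₀ ] ∃[ b₁ ] ∃[ b₂ ]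
  ((norm² b₀ b₁ b₂ ≡ norm² a₀ a₁ a₂)
  × (b₀ ≢ a₀) × (b₁ ≢ a₀) × (b₂ ≢ a₀)
  × (b₀ ≢ - a₀) × (b₁ ≢ - a₀) × (b₂ ≢ - a₀))

avoiding⇒representation : ∀ a₀ a₁ a₂ {b₀ b₁ b₂} →
  norm² b₀ b₁ b₂ ≡ norm² a₀ a₁ a₂ → Avoiding a₀ b₀ b₁ b₂ → AvoidingRepresentation a₀ a₁ a₂
avoiding⇒representation _ _ _ {b₀} {b₁} {b₂} eq ((p₀ , q₀) , (p₁ , q₁) , (p₂ , q₂)) =
  b₀ , b₁ , b₂ , eq , p₀ , p₁ , p₂ , q₀ , q₁ , q₂

≡0-mod⇒multiple : ∀ {x d} → x ≡ + 0 [mod d ] → ∃[ k ] x ≡ k * d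
≡0-mod⇒multiple {x} x≡0 with ∣ᵤ⇒∣ x≡0
... | divides k x-0≡kd = k , trans (sym (+-identityʳ x)) x-0≡kd

∣-incongruent : ∀ {d x y} → ¬ d ∣ y - x → d ∣ x → ¬ d ∣ y
∣-incongruent d∤y-x d∣x d∣y = d∤y-x (∣m∣n⇒∣m-n d∣y d∣x)

∤-congruent : ∀ {d x y} → d ∣ y - x → ¬ d ∣ x → ¬ d ∣ y
∤-congruent {d} {x} {y} d∣y-x d∤x d∣y = d∤x (subst (d ∣_) (x≡y-[y-x] x y) (∣m∣n⇒∣m-n d∣y d∣y-x))
  where
  x≡y-[y-x] : ∀ x y → y - (y - x) ≡ x
  x≡y-[y-x] = solve-∀

∤-difference : ∀ {d} x y r s → d ∣ x - r → d ∣ y - s → ¬ d ∣ r - s → ¬ d ∣ x - y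
∤-difference {d} x y r s d∣x-r d∣y-s d∤r-s d∣x-y =
  d∤r-s (subst (d ∣_) (regroup x y r s) (∣m∣n⇒∣m-n d∣x-y (∣m∣n⇒∣m-n d∣x-r d∣y-s)))
  where
  regroup : ∀ x y r s → (x - y) - ((x - r) - (y - s)) ≡ r - s
  regroup = solve-∀

∤⇒≢± : ∀ {d a x} → d ∣ a → ¬ d ∣ x → x ≢± a
∤⇒≢± d∣a d∤x = (λ { refl → d∤x d∣a }) , (λ { refl → d∤x (∣m⇒∣-m d∣a) })

≢±-either : ∀ {a x y} → y - x ≢ 0ℤ → y - x ≢± a + a → x ≢± a ⊎ y ≢± a
≢±-either {a} {x} δ≢0 (δ≢2a , δ≢-2a) with x ≟ a | x ≟ - a
... | yes refl | _ =
  inj₂ ( (λ { refl → δ≢0 (+-inverseʳ a) })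
       , (λ { refl → δ≢-2a (sym (neg-distrib-+ a a)) }))
... | no _ | yes refl =
  inj₂ ( (λ { refl → δ≢2a (cong (λ b → a + b) (neg-involutive a)) })
       , (λ { refl → δ≢0 (+-inverseʳ (- a)) }))
... | no x≢a | no x≢-a = inj₁ (x≢a , x≢-a)

≢±-either-multiple : ∀ {k m c x y} → k ≢ 0ℤ → y - x ≡ k * c → c ≢ 0ℤ → c ≢± m + m →
  x ≢± k * m ⊎ y ≢± k * m
≢±-either-multiple {k} {m} {c} {x} {y} k≢0 δ≡kc c≢0 (c≢2m , c≢-2m) =
  ≢±-either (≢k* c≢0 (sym (*-zeroʳ k))) (≢k* c≢2m 2a≡k[2m] , ≢k* c≢-2m -2a≡k[-2m])
  where
  ≢k* : ∀ {c′ e} → c ≢ c′ → e ≡ k * c′ → y - x ≢ e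
  ≢k* c≢c′ e≡kc′ δ≡e = c≢c′ (*-cancelˡ-≡ k c _ {{≢-nonZero k≢0}} (trans (sym δ≡kc) (trans δ≡e e≡kc′)))
  2a≡k[2m] : k * m + k * m ≡ k * (m + m)
  2a≡k[2m] = sym (*-distribˡ-+ k m m)
  -2a≡k[-2m] : - (k * m + k * m) ≡ k * - (m + m)
  -2a≡k[-2m] = trans (cong -_ 2a≡k[2m]) (neg-distribʳ-* k (m + m))

≢±-both-congruent : ∀ {d a x y} → d ∣ a → d ∣ y - x → ¬ d ∣ x → x ≢± a × y ≢± a
≢±-both-congruent d∣a d∣y-x d∤x = ∤⇒≢± d∣a d∤x , ∤⇒≢± d∣a (∤-congruent d∣y-x d∤x)

avoiding-either : ∀ {d a u₀ u₁ u₂ v₀ v₁ v₂} → d ∣ a →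
  ¬ d ∣ u₁ - u₀ → ¬ d ∣ u₂ - u₀ → ¬ d ∣ u₂ - u₁ →
  d ∣ v₀ - u₀ → d ∣ v₁ - u₁ → d ∣ v₂ - u₂ →
  u₀ ≢± a ⊎ v₀ ≢± a → u₁ ≢± a ⊎ v₁ ≢± a → u₂ ≢± a ⊎ v₂ ≢± a →
  Avoiding a u₀ u₁ u₂ ⊎ Avoiding a v₀ v₁ v₂
avoiding-either {d} {u₀ = u₀} {u₁} d∣a d∤u₁-u₀ d∤u₂-u₀ d∤u₂-u₁ d∣δ₀ d∣δ₁ d∣δ₂ either₀ either₁ either₂
  with d ∣? u₀ | d ∣? u₁
... | yes d∣u₀ | _ =
  let u₁≢± , v₁≢± = ≢±-both-congruent d∣a d∣δ₁ (∣-incongruent d∤u₁-u₀ d∣u₀)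
      u₂≢± , v₂≢± = ≢±-both-congruent d∣a d∣δ₂ (∣-incongruent d∤u₂-u₀ d∣u₀)
  in map (_, u₁≢± , u₂≢±) (_, v₁≢± , v₂≢±) either₀
... | no d∤u₀ | yes d∣u₁ =
  let u₀≢± , v₀≢± = ≢±-both-congruent d∣a d∣δ₀ d∤u₀
      u₂≢± , v₂≢± = ≢±-both-congruent d∣a d∣δ₂ (∣-incongruent d∤u₂-u₁ d∣u₁)
  in map (λ p → u₀≢± , p , u₂≢±) (λ q → v₀≢± , q , v₂≢±) either₁
... | no d∤u₀ | no d∤u₁ =
  let u₀≢± , v₀≢± = ≢±-both-congruent d∣a d∣δ₀ d∤u₀
      u₁≢± , v₁≢± = ≢±-both-congruent d∣a d∣δ₁ d∤u₁
  in map (λ p → u₀≢± , u₁≢± , p) (λ q → v₀≢± , v₁≢± , q) either₂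

-- If x + y + z = 3t, then (reflect t x, reflect t y, reflect t z) is the mirror image of (x, y, z)
-- in the plane orthogonal to (1, 1, 1).
reflect : ℤ → ℤ → ℤ
reflect t x = x - + 2 * t

norm²-reflect : ∀ x y z t → x + y + z ≡ t * + 3 →
  norm² (reflect t x) (reflect t y) (reflect t z) ≡ norm² x y z
norm²-reflect x y z t x+y+z≡3t = begin
  norm² (reflect t x) (reflect t y) (reflect t z)  ≡⟨ expand x y z t ⟩
  norm² x y z + + 4 * t * (t * + 3 - (x + y + z))  ≡⟨ cong (λ s → norm² x y z + + 4 * t * (t * + 3 - s)) x+y+z≡3t ⟩
  norm² x y z + + 4 * t * (t * + 3 - t * + 3)      ≡⟨ cancel (norm² x y z) t (t * + 3) ⟩
  norm² x y z                                      ∎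
  where
  open ≡-Reasoning
  expand : ∀ x y z t →
    (x - + 2 * t) * (x - + 2 * t) + (y - + 2 * t) * (y - + 2 * t) + (z - + 2 * t) * (z - + 2 * t)
    ≡ x * x + y * y + z * z + + 4 * t * (t * + 3 - (x + y + z))
  expand = solve-∀
  cancel : ∀ n t s → n + + 4 * t * (s - s) ≡ n
  cancel = solve-∀

norm²-neg : ∀ x y z → norm² (- x) y z ≡ norm² x y z
norm²-neg = unfolded
  where
  unfolded : ∀ x y z → - x * - x + y * y + z * z ≡ x * x + y * y + z * z
  unfolded = solve-∀

reflect-difference : ∀ t x y → reflect t y - reflect t x ≡ y - x
reflect-difference = unfolded
  where
  unfolded : ∀ t x y → (y - + 2 * t) - (x - + 2 * t) ≡ y - x
  unfolded = solve-∀

reflections-avoid : ∀ k a₁ a₂ t → k ≢ 0ℤ →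
  ¬ + 3 ∣ a₁ - k * + 9 → ¬ + 3 ∣ a₂ - k * + 9 → ¬ + 3 ∣ a₂ - a₁ →
  Avoiding (k * + 9) (reflect t (k * + 9)) (reflect t a₁) (reflect t a₂)
  ⊎ Avoiding (k * + 9) (reflect (t - k * + 6) (- (k * + 9))) (reflect (t - k * + 6) a₁) (reflect (t - k * + 6) a₂)
reflections-avoid k a₁ a₂ t k≢0 3∤a₁-a₀ 3∤a₂-a₀ 3∤a₂-a₁ =
  avoiding-either (∣n⇒∣m*n k (divides (+ 3) refl))
    (reflect-incongruent a₀ a₁ 3∤a₁-a₀)
    (reflect-incongruent a₀ a₂ 3∤a₂-a₀)
    (reflect-incongruent a₁ a₂ 3∤a₂-a₁)
    (3∣k* (divides (- + 2) refl) v₀-u₀)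
    (3∣k* (divides (+ 4) refl) (vᵢ-uᵢ a₁))
    (3∣k* (divides (+ 4) refl) (vᵢ-uᵢ a₂))
    (≢±-either-multiple k≢0 v₀-u₀ (λ ()) ((λ ()) , (λ ())))
    (≢±-either-multiple k≢0 (vᵢ-uᵢ a₁) (λ ()) ((λ ()) , (λ ())))
    (≢±-either-multiple k≢0 (vᵢ-uᵢ a₂) (λ ()) ((λ ()) , (λ ())))
  where
  a₀ t′ : ℤ
  a₀ = k * + 9
  t′ = t - k * + 6

  reflect-incongruent : ∀ x y → ¬ + 3 ∣ y - x → ¬ + 3 ∣ reflect t y - reflect t x
  reflect-incongruent x y = subst (λ δ → ¬ + 3 ∣ δ) (sym (reflect-difference t x y))

  3∣k* : ∀ {c δ} → + 3 ∣ c → δ ≡ k * c → + 3 ∣ δ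
  3∣k* 3∣c δ≡kc = subst (+ 3 ∣_) (sym δ≡kc) (∣n⇒∣m*n k 3∣c)

  v₀-u₀ : reflect t′ (- a₀) - reflect t a₀ ≡ k * - + 6
  v₀-u₀ = unfolded k t
    where
    unfolded : ∀ k t → (- (k * + 9) - + 2 * (t - k * + 6)) - (k * + 9 - + 2 * t) ≡ k * - + 6
    unfolded = solve-∀

  vᵢ-uᵢ : ∀ a → reflect t′ a - reflect t a ≡ k * + 12
  vᵢ-uᵢ a = unfolded k t a
    where
    unfolded : ∀ k t a → (a - + 2 * (t - k * + 6)) - (a - + 2 * t) ≡ k * + 12
    unfolded = solve-∀

avoiding-representation-9k : ∀ k a₁ a₂ → k ≢ 0ℤ → + 3 ∣ a₁ - + 1 → + 3 ∣ a₂ - + 2 →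
  AvoidingRepresentation (k * + 9) a₁ a₂
avoiding-representation-9k k a₁ a₂ k≢0 3∣a₁-1 3∣a₂-2 =
  [ avoiding⇒representation a₀ a₁ a₂ (norm²-reflect a₀ a₁ a₂ t a₀+a₁+a₂≡3t)
  , avoiding⇒representation a₀ a₁ a₂ norm²-reflect-neg
  ]′
  (reflections-avoid k a₁ a₂ t k≢0
       (∤-difference a₁ a₀ (+ 1) (+ 0) 3∣a₁-1 3∣a₀-0 3∤1)
       (∤-difference a₂ a₀ (+ 2) (+ 0) 3∣a₂-2 3∣a₀-0 3∤2)
       (∤-difference a₂ a₁ (+ 2) (+ 1) 3∣a₂-2 3∣a₁-1 3∤1))
  where
  open ≡-Reasoning
  a₀ t t′ : ℤ
  a₀ = k * + 9

  3∤1 : ¬ + 3 ∣ + 1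
  3∤1 = from-no (+ 3 ∣? + 1)
  3∤2 : ¬ + 3 ∣ + 2
  3∤2 = from-no (+ 3 ∣? + 2)

  3∣a₀-0 : + 3 ∣ a₀ - + 0
  3∣a₀-0 = divides (k * + 3) (unfolded k)
    where
    unfolded : ∀ k → k * + 9 - + 0 ≡ k * + 3 * + 3
    unfolded = solve-∀

  3∣a₀+a₁+a₂ : + 3 ∣ a₀ + a₁ + a₂
  3∣a₀+a₁+a₂ = subst (+ 3 ∣_) (regroup a₀ a₁ a₂)
    (∣m∣n⇒∣m+n (∣m∣n⇒∣m+n (∣m∣n⇒∣m+n 3∣a₀-0 3∣a₁-1) 3∣a₂-2) ∣-refl)
    where
    regroup : ∀ a₀ a₁ a₂ → (a₀ - + 0) + (a₁ - + 1) + (a₂ - + 2) + + 3 ≡ a₀ + a₁ + a₂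
    regroup = solve-∀

  t = _∣_.quotient 3∣a₀+a₁+a₂
  t′ = t - k * + 6

  a₀+a₁+a₂≡3t : a₀ + a₁ + a₂ ≡ t * + 3
  a₀+a₁+a₂≡3t = _∣_.equality 3∣a₀+a₁+a₂

  -a₀+a₁+a₂≡3t′ : - a₀ + a₁ + a₂ ≡ t′ * + 3
  -a₀+a₁+a₂≡3t′ = begin
    - a₀ + a₁ + a₂             ≡⟨ subtract-2a₀ k a₁ a₂ ⟩
    a₀ + a₁ + a₂ - k * + 18    ≡⟨ cong (_- k * + 18) a₀+a₁+a₂≡3t ⟩
    t * + 3 - k * + 18         ≡⟨ factor k t ⟩
    t′ * + 3                   ∎
    where
    subtract-2a₀ : ∀ k a₁ a₂ → - (k * + 9) + a₁ + a₂ ≡ k * + 9 + a₁ + a₂ - k * + 18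
    subtract-2a₀ = solve-∀
    factor : ∀ k t → t * + 3 - k * + 18 ≡ (t - k * + 6) * + 3
    factor = solve-∀

  norm²-reflect-neg : norm² (reflect t′ (- a₀)) (reflect t′ a₁) (reflect t′ a₂) ≡ norm² a₀ a₁ a₂
  norm²-reflect-neg = trans (norm²-reflect (- a₀) a₁ a₂ t′ -a₀+a₁+a₂≡3t′) (norm²-neg a₀ a₁ a₂)

proposition3p5 : (a₀ a₁ a₂ : ℤ) → a₀ ≢ + 0 → a₁ ≢ + 0 → a₂ ≢ + 0
    → a₀ ≡ + 0 [mod + 9 ] → a₁ ≡ + 1 [mod + 3 ] → a₂ ≡ + 2 [mod + 3 ]
    → ∃[ b₀ ] ∃[ b₁ ] ∃[ b₂ ]
        ((b₀ * b₀ + b₁ * b₁ + b₂ * b₂ ≡ a₀ * a₀ + a₁ * a₁ + a₂ * a₂)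
        × (b₀ ≢ a₀) × (b₁ ≢ a₀) × (b₂ ≢ a₀)
        × (b₀ ≢ - a₀) × (b₁ ≢ - a₀) × (b₂ ≢ - a₀))
proposition3p5 a₀ a₁ a₂ a₀≢0 _ _ a₀≡0 a₁≡1 a₂≡2 with ≡0-mod⇒multiple {a₀} {+ 9} a₀≡0
... | k , refl = avoiding-representation-9k k a₁ a₂ (λ { refl → a₀≢0 refl }) (∣ᵤ⇒∣ a₁≡1) (∣ᵤ⇒∣ a₂≡2)
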